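{- Let $n,m\ge 1$, let $R\le D_4$ (or, if $m=n$, $R\le D_8$), and let $T$ and $T'$ be two sets of tile designs for $R$ such that, for every conjugacy class of subgroups $S\le R$, the number $\mathcal{O}^R_S$ of $R$-orbits of $T$ containing a design whose stabilizer is conjugate to $S$ equals the corresponding number for $T'$. Then the number of tilings by $T$ of the $n\times m$ grid counted up to $R$ (respectively of the $n\times m$ cylinder counted up to $\mathbb{Z}/n\mathbb{Z}\rtimes R$, respectively of the $n\times m$ torus counted up to $(\mathbb{Z}/n\mathbb{Z}\times\mathbb{Z}/m\mathbb{Z})\rtimes R$) equals the corresponding number of tilings by $T'$. In other words, the number of tilings depends only on the tuple $(\mathcal{O}^R_S)_{S}$ indexed by conjugacy classes of subgroups of $R$.
   Context: The $n\times m$ grid is the set of cells $\mathbb{Z}/n\mathbb{Z}\times\mathbb{Z}/m\mathbb{Z}$, written $(x,y)$ with representatives $0\le x<n$, $0\le y<m$. Let $D_8=\langle r,f\mid r^4=f^2=(rf)^2=\mathrm{id}\rangle$ and $D_4=\langle r^2,f\rangle\le D_8$. $D_4$ acts on cells on the right by $(x,y)\cdot f=(n-1-x,y)$, $(x,y)\cdot r^2=(n-1-x,m-1-y)$; when $m=n$, $D_8$ acts on the right with additionally $(x,y)\cdot r=(n-1-y,x)$. A set of tile designs for $R$ is a finite set $T$ with a right action of $R$. A tiling is a map $\tau$ from the cells to $T$. The grid symmetries: $g\in R$ acts on tilings by $(\tau\cdot g)(c\cdot g)=\tau(c)\cdot g$. Cylinder symmetries: pairs $(a,g)$, $a\in\mathbb{Z}/n\mathbb{Z}$,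 $g\in R\le D_4$, act on cells by $(x,y)\cdot(a,g)=(x+a,y)\cdot g$ and on tilings by $(\tau\cdot(a,g))(c\cdot(a,g))=\tau(c)\cdot g$. Torus symmetries: triples $((a,b),g)$, $(a,b)\in\mathbb{Z}/n\mathbb{Z}\times\mathbb{Z}/m\mathbb{Z}$, $g\in R$, act on cells by $(x,y)\cdot((a,b),g)=(x+a,y+b)\cdot g$ and on tilings by $(\tau\cdot s)(c\cdot s)=\tau(c)\cdot g$. These form right actions of the semidirect products $\mathbb{Z}/n\mathbb{Z}\rtimes R$ and $(\mathbb{Z}/n\mathbb{Z}\times\mathbb{Z}/m\mathbb{Z})\rtimes R$, and "counted up to" a group means the number of orbits of tilings under it. -}

module Defs where

open import Data.Nat using (ℕ; NonZero; _+_)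
open import Data.Nat.DivMod using (_%_; m%n<n)
open import Data.Fin using (Fin; toℕ; fromℕ<; opposite)
open import Data.Bool using (Bool; true; false; T; _xor_; if_then_else_)
open import Data.Product using (Σ; _×_; _,_)
open import Data.Unit using (⊤)
open import Relation.Binary.PropositionalEquality using (_≡_)

-- The dihedral group D8 = ⟨ r, f ∣ r⁴ = f² = (rf)² = id ⟩.
-- An element  mkD8 i a  stands for  r^i f^a  (i ∈ ℤ/4, a ∈ ℤ/2).

data Rot : Set where
  ρ0 ρ1 ρ2 ρ3 : Rot

_+r_ : Rot → Rot → Rot
ρ0 +r j  = j
ρ1 +r ρ0 = ρ1
ρ1 +r ρ1 = ρ2
ρ1 +r ρ2 = ρ3
ρ1 +r ρ3 = ρ0
ρ2 +r ρ0 = ρ2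
ρ2 +r ρ1 = ρ3
ρ2 +r ρ2 = ρ0
ρ2 +r ρ3 = ρ1
ρ3 +r ρ0 = ρ3
ρ3 +r ρ1 = ρ0
ρ3 +r ρ2 = ρ1
ρ3 +r ρ3 = ρ2

-r_ : Rot → Rot
-r ρ0 = ρ0
-r ρ1 = ρ3
-r ρ2 = ρ2
-r ρ3 = ρ1

record D8 : Set where
  constructor mkD8
  field
    rot : Rot
    flp : Bool
open D8 public

e : D8
e = mkD8 ρ0 false

-- (r^i f^a)(r^j f^b) = r^(i + (-1)^a j) f^(a+b)   (since f r = r⁻¹ f)
_∙_ : D8 → D8 → D8
mkD8 i a ∙ mkD8 j b = mkD8 (i +r (if a then -r j else j)) (a xor b)
infixl 7 _∙_

_⁻¹ : D8 → D8
mkD8 i false ⁻¹ = mkD8 (-r i) false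
mkD8 i true  ⁻¹ = mkD8 i true
infix 8 _⁻¹

-- D4 = ⟨ r², f ⟩ ≤ D8
data IsD4 : D8 → Set where
  d0 : (b : Bool) → IsD4 (mkD8 ρ0 b)
  d2 : (b : Bool) → IsD4 (mkD8 ρ2 b)

record Subgroup : Set where
  field
    mem   : D8 → Bool
    mem-e : T (mem e)
    mem-∙ : ∀ g h → T (mem g) → T (mem h) → T (mem (g ∙ h))
    mem-⁻¹ : ∀ g → T (mem g) → T (mem (g ⁻¹))
open Subgroup public

_≤G_ : Subgroup → Subgroup → Set
S ≤G R = ∀ g → T (mem S g) → T (mem R g)

InD4 : Subgroup → Set
InD4 R = ∀ g → T (mem R g) → IsD4 g

-- A set of tile designs for R: a finite set (w.l.o.g. Fin k) with a
-- right action of R.  The action map is given on all of D8 but only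
-- required to be an action on elements of R; values outside R are never
-- used anywhere below.

record TileSet (R : Subgroup) (k : ℕ) : Set where
  field
    act   : Fin k → D8 → Fin k
    act-e : ∀ t → act t e ≡ t
    act-∙ : ∀ t g h → T (mem R g) → T (mem R h) →
            act t (g ∙ h) ≡ act (act t g) h
open TileSet public

DesignRel : {R : Subgroup} {k : ℕ} → TileSet R k → Fin k → Fin k → Set
DesignRel {R} A t t' = Σ D8 λ g → T (mem R g) × act A t g ≡ t'

StabConj : {R : Subgroup} {k : ℕ} → TileSet R k → Subgroup → Fin k → Set
StabConj {R} A S t =
  Σ D8 λ h → T (mem R h) ×
    (∀ g → ((T (mem R g) × act A t g ≡ t) → T (mem S (h ⁻¹ ∙ g ∙ h)))
         × (T (mem S (h ⁻¹ ∙ g ∙ h)) → (T (mem R g) × act A t g ≡ t)))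

-- For a relation _~_ (the orbit relation of a group
-- action on X), "OrbitCountWhere _~_ P N" says: the set of orbits which
-- contain an element satisfying P has exactly N elements, witnessed by N
-- pairwise inequivalent representatives of such orbits covering all such
-- orbits.

OrbitCountWhere : {X : Set} → (X → X → Set) → (X → Set) → ℕ → Set
OrbitCountWhere {X} _~_ P N =
  Σ (Fin N → X) λ rep →
      (∀ i j → rep i ~ rep j → i ≡ j)
    × (∀ i → Σ X λ x → rep i ~ x × P x)
    × (∀ x → P x → Σ (Fin N) λ i → rep i ~ x)

OrbitCount : {X : Set} → (X → X → Set) → ℕ → Set
OrbitCount _~_ N = OrbitCountWhere _~_ (λ _ → ⊤) N

SameOrbitCount : {X Y : Set} → (X → X → Set) → (Y → Y → Set) → Set
SameOrbitCount _~_ _≈_ = Σ ℕ λ N → OrbitCount _~_ N × OrbitCount _≈_ N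

SameOrbitTypes : {R : Subgroup} {k k' : ℕ} → TileSet R k → TileSet R k' → Set
SameOrbitTypes {R} A A' =
  (S : Subgroup) → S ≤G R →
  Σ ℕ λ N → OrbitCountWhere (DesignRel A) (StabConj A S) N
          × OrbitCountWhere (DesignRel A') (StabConj A' S) N

Cell : ℕ → ℕ → Set
Cell n m = Fin n × Fin m

_⊕_ : {n : ℕ} .{{_ : NonZero n}} → Fin n → Fin n → Fin n
_⊕_ {n} x a = fromℕ< (m%n<n (toℕ x + toℕ a) n)

flipCell : {n m : ℕ} → Cell n m → Cell n m
flipCell (x , y) = (opposite x , y)

flipIf : {n m : ℕ} → Bool → Cell n m → Cell n m
flipIf false c = c
flipIf true  c = flipCell c

cellAct4 : {n m : ℕ} → (g : D8) → IsD4 g → Cell n m → Cell n m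
cellAct4 .(mkD8 ρ0 b) (d0 b) c       = flipIf b c
cellAct4 .(mkD8 ρ2 b) (d2 b) (x , y) = flipIf b (opposite x , opposite y)

rotCell : {n : ℕ} → Rot → Cell n n → Cell n n
rotCell ρ0 c       = c
rotCell ρ1 (x , y) = (opposite y , x)
rotCell ρ2 (x , y) = (opposite x , opposite y)
rotCell ρ3 (x , y) = (y , opposite x)

cellAct8 : {n : ℕ} → D8 → Cell n n → Cell n n
cellAct8 (mkD8 i a) c = flipIf a (rotCell i c)

-- A symmetry s (with side
-- condition ok s) acting on cells by cact and on designs by lbl s ∈ R
-- maps τ to τ·s with (τ·s)(c·s) = τ(c)·(lbl s).  τ ~ τ' iff τ' = τ·s for
-- some admissible s.

TilingRel : {C S : Set} {k : ℕ} → (ok : S → Set) → (lbl : S → D8) →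
            (cact : (s : S) → ok s → C → C) → (Fin k → D8 → Fin k) →
            (C → Fin k) → (C → Fin k) → Set
TilingRel {C} {S} ok lbl cact act τ τ' =
  Σ S λ s → Σ (ok s) λ o → ∀ (c : C) → τ' (cact s o c) ≡ act (τ c) (lbl s)

module _ {k : ℕ} (R : Subgroup) (A : TileSet R k) where

  GridRel4 : (n m : ℕ) → (Cell n m → Fin k) → (Cell n m → Fin k) → Set
  GridRel4 n m = TilingRel {S = D8} (λ g → T (mem R g) × IsD4 g) (λ g → g)
                   (λ g o → cellAct4 g (Data.Product.proj₂ o)) (act A)

  CylRel : (n m : ℕ) .{{_ : NonZero n}} → (Cell n m → Fin k) → (Cell n m → Fin k) → Set
  CylRel n m = TilingRel {S = Fin n × D8}
                 (λ { (a , g) → T (mem R g) × IsD4 g })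
                 (λ { (a , g) → g })
                 (λ { (a , g) (_ , d) (x , y) → cellAct4 g d (x ⊕ a , y) })
                 (act A)

  TorusRel4 : (n m : ℕ) .{{_ : NonZero n}} .{{_ : NonZero m}} →
              (Cell n m → Fin k) → (Cell n m → Fin k) → Set
  TorusRel4 n m = TilingRel {S = (Fin n × Fin m) × D8}
                    (λ { (_ , g) → T (mem R g) × IsD4 g })
                    (λ { (_ , g) → g })
                    (λ { ((a , b) , g) (_ , d) (x , y) → cellAct4 g d (x ⊕ a , y ⊕ b) })
                    (act A)

  GridRel8 : (n : ℕ) → (Cell n n → Fin k) → (Cell n n → Fin k) → Set
  GridRel8 n = TilingRel {S = D8} (λ g → T (mem R g)) (λ g → g)
                 (λ g _ → cellAct8 g) (act A)

  TorusRel8 : (n : ℕ) .{{_ : NonZero n}} → (Cell n n → Fin k) → (Cell n n → Fin k) → Set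
  TorusRel8 n = TilingRel {S = (Fin n × Fin n) × D8}
                  (λ { (_ , g) → T (mem R g) })
                  (λ { (_ , g) → g })
                  (λ { ((a , b) , g) _ (x , y) → cellAct8 g (x ⊕ a , y ⊕ b) })
                  (act A)

-- For finite R-sets, having the same number of orbits of each type [S] forces an
-- R-equivariant bijection T ≅ T': in every orbit of type [S] pick a basepoint whose
-- stabiliser is exactly S, and send the i-th such orbit of T to the i-th such orbit of T'
-- by basepoint · g ↦ basepoint' · g, which is well defined because both basepoints have
-- stabiliser S. Composing tilings with this bijection commutes with every grid, cylinder
-- and torus symmetry, so it matches their orbits; there are finitely many orbits because
-- tilings can be enumerated and the orbit relations are decidable. As the hypothesis is
-- stated subgroup by subgroup, each conjugacy class is represented by a canonical
-- subgroup: the conjugate whose membership table has the least code.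
module Submission where

open import Defs
open import Data.Bool using (Bool; true; false; T; _∧_)
open import Data.Bool.Properties using (T-∧; T-irrelevant)
open import Data.Empty using (⊥-elim)
open import Data.Fin using (Fin; zero; suc; toℕ; opposite; combine; remQuot; funToFin; finToFun; _≤_)
open import Data.Fin.Properties
  using (toℕ-injective; toℕ-fromℕ<; toℕ<n; opposite-prop; opposite-involutive; remQuot-combine;
         finToFun-funToFin; 2↔Bool; ≤-totalOrder; ≤-antisym)
  renaming (_≟_ to _≟ᶠ_; any? to anyFin?; all? to allFin?)
open import Data.List
  using (List; []; _∷_; [_]; filter; tabulate; length; lookup; map; cartesianProductWith; allFin)
open import Data.List.Membership.Propositional using (_∈_; lose)
open import Data.List.Membership.Propositional.Properties
  using (∈-filter⁺; ∈-tabulate⁺; ∈-lookup; ∈-allFin)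
import Data.List.Membership.Setoid.Properties as Setoidᴹ
import Data.List.Relation.Unary.All as All
open import Data.List.Relation.Unary.All.Properties using (all-filter)
open import Data.List.Relation.Unary.Any as Any using (Any; here; there)
open import Data.List.Relation.Unary.Any.Properties using (lookup-result)
open import Data.List.Relation.Unary.Enumerates.Setoid using (IsEnumeration)
open import Data.Nat using (ℕ; suc; _+_; _*_; _∸_; _^_; NonZero)
open import Data.Nat.DivMod
  using (_%_; _/_; _mod_; %-distribˡ-+; m%n%n≡m%n; [m+n]%n≡m%n; [m+kn]%n≡m%n; m<n⇒m%n≡m;
         m≡m%n+[m/n]*n)
open import Data.Nat.Properties using (+-identityʳ; +-cancelʳ-≡; m∸n+n≡m; <⇒≤)
open import Data.Nat.Tactic.RingSolver using (solve-∀)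
open import Data.Product using (Σ; _×_; _,_; proj₁; proj₂; uncurry)
open import Data.Unit using (tt)
import Data.Vec.Functional as Vector
open import Function using (_∘_; Inverse; Equivalence)
open import Level using (0ℓ)
open import Relation.Binary.Bundles using (Setoid)
open import Relation.Binary.Definitions using (DecidableEquality; Symmetric; _Respectsʳ_)
  renaming (Decidable to Decidable₂)
open import Relation.Binary.PropositionalEquality hiding ([_])
open import Relation.Nullary using (Dec; yes; no; ¬_; _×-dec_; _→-dec_)
open import Relation.Nullary.Decidable using (map′; from-yes; T?; isYes; toWitness; fromWitness)
open import Relation.Unary using (Pred; Decidable)

-- D8 as a finite group

fromFin : Fin 8 → D8
fromFin zero                                         = mkD8 ρ0 false
fromFin (suc zero)                                   = mkD8 ρ1 false
fromFin (suc (suc zero))                             = mkD8 ρ2 false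
fromFin (suc (suc (suc zero)))                       = mkD8 ρ3 false
fromFin (suc (suc (suc (suc zero))))                 = mkD8 ρ0 true
fromFin (suc (suc (suc (suc (suc zero)))))           = mkD8 ρ1 true
fromFin (suc (suc (suc (suc (suc (suc zero))))))     = mkD8 ρ2 true
fromFin (suc (suc (suc (suc (suc (suc (suc _)))))))  = mkD8 ρ3 true

toFin : D8 → Fin 8
toFin (mkD8 ρ0 false) = zero
toFin (mkD8 ρ1 false) = suc zero
toFin (mkD8 ρ2 false) = suc (suc zero)
toFin (mkD8 ρ3 false) = suc (suc (suc zero))
toFin (mkD8 ρ0 true)  = suc (suc (suc (suc zero)))
toFin (mkD8 ρ1 true)  = suc (suc (suc (suc (suc zero))))
toFin (mkD8 ρ2 true)  = suc (suc (suc (suc (suc (suc zero)))))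
toFin (mkD8 ρ3 true)  = suc (suc (suc (suc (suc (suc (suc zero))))))

fromFin-toFin : ∀ g → fromFin (toFin g) ≡ g
fromFin-toFin (mkD8 ρ0 false) = refl
fromFin-toFin (mkD8 ρ1 false) = refl
fromFin-toFin (mkD8 ρ2 false) = refl
fromFin-toFin (mkD8 ρ3 false) = refl
fromFin-toFin (mkD8 ρ0 true)  = refl
fromFin-toFin (mkD8 ρ1 true)  = refl
fromFin-toFin (mkD8 ρ2 true)  = refl
fromFin-toFin (mkD8 ρ3 true)  = refl

allD8 : List D8
allD8 = tabulate fromFin

∈-allD8 : ∀ g → g ∈ allD8
∈-allD8 g = subst (_∈ allD8) (fromFin-toFin g) (∈-tabulate⁺ {f = fromFin} (toFin g))

infix 4 _≟_
_≟_ : DecidableEquality D8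
g ≟ h = map′ (λ p → trans (sym (fromFin-toFin g)) (trans (cong fromFin p) (fromFin-toFin h)))
             (cong toFin) (toFin g ≟ᶠ toFin h)

any? : {P : Pred D8 0ℓ} → Decidable P → Dec (Σ D8 P)
any? {P} P? = map′ (λ (i , p) → fromFin i , p)
                   (λ (g , p) → toFin g , subst P (sym (fromFin-toFin g)) p)
                   (anyFin? (λ i → P? (fromFin i)))

all? : {P : Pred D8 0ℓ} → Decidable P → Dec (∀ g → P g)
all? {P} P? = map′ (λ p g → subst P (fromFin-toFin g) (p (toFin g))) (λ p i → p (fromFin i))
                   (allFin? (λ i → P? (fromFin i)))

∙-inverseʳ : ∀ g → g ∙ g ⁻¹ ≡ e
∙-inverseʳ = from-yes (all? λ g → g ∙ g ⁻¹ ≟ e)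

∙-⁻¹-cancelʳ : ∀ g h → g ∙ h ⁻¹ ∙ h ≡ g
∙-⁻¹-cancelʳ = from-yes (all? λ g → all? λ h → g ∙ h ⁻¹ ∙ h ≟ g)

∙-⁻¹-cancelˡ : ∀ g h → g ∙ (g ⁻¹ ∙ h) ≡ h
∙-⁻¹-cancelˡ = from-yes (all? λ g → all? λ h → g ∙ (g ⁻¹ ∙ h) ≟ h)

conj-∙ : ∀ x y g → x ∙ (y ∙ g ∙ y ⁻¹) ∙ x ⁻¹ ≡ x ∙ y ∙ g ∙ (x ∙ y) ⁻¹
conj-∙ = from-yes (all? λ x → all? λ y → all? λ g →
  x ∙ (y ∙ g ∙ y ⁻¹) ∙ x ⁻¹ ≟ x ∙ y ∙ g ∙ (x ∙ y) ⁻¹)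

conj-cancelˡ : ∀ x g → x ⁻¹ ∙ (x ∙ g ∙ x ⁻¹) ∙ x ≡ g
conj-cancelˡ = from-yes (all? λ x → all? λ g → x ⁻¹ ∙ (x ∙ g ∙ x ⁻¹) ∙ x ≟ g)

conj-cancelʳ : ∀ x g → x ∙ (x ⁻¹ ∙ g ∙ x) ∙ x ⁻¹ ≡ g
conj-cancelʳ = from-yes (all? λ x → all? λ g → x ∙ (x ⁻¹ ∙ g ∙ x) ∙ x ⁻¹ ≟ g)

-- Subgroups of D8 and their conjugacy classes

T-injective : ∀ {a b} → (T a → T b) → (T b → T a) → a ≡ b
T-injective {false} {false} _ _ = refl
T-injective {false} {true}  _ g = ⊥-elim (g _)
T-injective {true}  {false} f _ = ⊥-elim (f _)
T-injective {true}  {true}  _ _ = refl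

IsSubgroupOf : Subgroup → (D8 → Bool) → Set
IsSubgroupOf R f =
    T (f e)
  × (∀ g h → T (f g) → T (f h) → T (f (g ∙ h)))
  × (∀ g → T (f g) → T (f (g ⁻¹)))
  × (∀ g → T (f g) → T (mem R g))

isSubgroupOf? : ∀ R f → Dec (IsSubgroupOf R f)
isSubgroupOf? R f =
      T? (f e)
  ×-dec all? (λ g → all? λ h → T? (f g) →-dec (T? (f h) →-dec T? (f (g ∙ h))))
  ×-dec all? (λ g → T? (f g) →-dec T? (f (g ⁻¹)))
  ×-dec all? (λ g → T? (f g) →-dec T? (mem R g))

IsSubgroupOf-resp : ∀ {R f f'} → (∀ g → f g ≡ f' g) → IsSubgroupOf R f → IsSubgroupOf R f'
IsSubgroupOf-resp {f = f} {f'} f≗f' (fe , f∙ , f⁻¹ , f⊆R) =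
    to fe
  , (λ g h p q → to (f∙ g h (from p) (from q)))
  , (λ g p → to (f⁻¹ g (from p)))
  , (λ g p → f⊆R g (from p))
  where
  to : ∀ {g} → T (f g) → T (f' g)
  to {g} = subst T (f≗f' g)
  from : ∀ {g} → T (f' g) → T (f g)
  from {g} = subst T (sym (f≗f' g))

toSubgroup : ∀ {R} f → IsSubgroupOf R f → Subgroup
toSubgroup f (fe , f∙ , f⁻¹ , _) = record { mem = f ; mem-e = fe ; mem-∙ = f∙ ; mem-⁻¹ = f⁻¹ }

funToFin-cong : ∀ {m n} {f g : Fin m → Fin n} → (∀ i → f i ≡ g i) → funToFin f ≡ funToFin g
funToFin-cong {ℕ.zero} _   = refl
funToFin-cong {suc m}  f≗g = cong₂ combine (f≗g zero) (funToFin-cong (f≗g ∘ suc))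

Code : Set
Code = Fin (2 ^ 8)

opaque
  bits : (D8 → Bool) → Fin 8 → Fin 2
  bits f i = Inverse.from 2↔Bool (f (fromFin i))

  code : (D8 → Bool) → Code
  code f = funToFin (bits f)

  decode : Code → D8 → Bool
  decode c g = Inverse.to 2↔Bool (finToFun c (toFin g))

  decode-code : ∀ f g → decode (code f) g ≡ f g
  decode-code f g = begin
    to (finToFun (code f) (toFin g))       ≡⟨ cong to (finToFun-funToFin (bits f) (toFin g)) ⟩
    to (from (f (fromFin (toFin g))))      ≡⟨ strictlyInverseˡ _ ⟩
    f (fromFin (toFin g))                  ≡⟨ cong f (fromFin-toFin g) ⟩
    f g                                    ∎
    where
    open ≡-Reasoning
    open Inverse 2↔Bool using (to; from; strictlyInverseˡ)

  code-cong : ∀ {f f'} → (∀ g → f g ≡ f' g) → code f ≡ code f'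
  code-cong f≗f' = funToFin-cong (λ i → cong (Inverse.from 2↔Bool) (f≗f' (fromFin i)))

-- The subgroup of R with the given code, or R itself if there is none.
opaque
  canonicalSubgroup : Subgroup → Code → Subgroup
  canonicalSubgroup R c with isSubgroupOf? R (decode c)
  ... | yes p = toSubgroup {R} (decode c) p
  ... | no _  = R

  canonicalSubgroup-≤ : ∀ R c → canonicalSubgroup R c ≤G R
  canonicalSubgroup-≤ R c with isSubgroupOf? R (decode c)
  ... | yes (_ , _ , _ , ⊆R) = ⊆R
  ... | no _                 = λ _ p → p

  mem-canonicalSubgroup : ∀ R c → IsSubgroupOf R (decode c) →
                          ∀ g → mem (canonicalSubgroup R c) g ≡ decode c g
  mem-canonicalSubgroup R c p g with isSubgroupOf? R (decode c)
  ... | yes _ = refl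
  ... | no ¬p = ⊥-elim (¬p p)

-- If f is the membership function of S, then f ⋆ x is that of x⁻¹ S x.
infixl 7 _⋆_
_⋆_ : (D8 → Bool) → D8 → D8 → Bool
(f ⋆ x) g = f (x ∙ g ∙ x ⁻¹)

⋆-∙ : ∀ f x y g → (f ⋆ x ⋆ y) g ≡ (f ⋆ (x ∙ y)) g
⋆-∙ f x y g = cong f (conj-∙ x y g)

module ClassKey (R : Subgroup) where
  open import Data.List.Extrema (≤-totalOrder (2 ^ 8)) using (argmin; f[argmin]≤f[xs]; argmin-all)

  elements : List D8
  elements = filter (T? ∘ mem R) allD8

  opaque
    representative : (D8 → Bool) → D8
    representative f = argmin (λ h → code (f ⋆ h)) e elements

    representative∈R : ∀ f → T (mem R (representative f))
    representative∈R f = argmin-all (λ h → code (f ⋆ h)) (mem-e R) (all-filter (T? ∘ mem R) allD8)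

    classKey : (D8 → Bool) → Code
    classKey f = code (f ⋆ representative f)

    classKey-representative : ∀ f → classKey f ≡ code (f ⋆ representative f)
    classKey-representative f = refl

    classKey-minimal : ∀ f {h} → T (mem R h) → classKey f ≤ code (f ⋆ h)
    classKey-minimal f {h} hR =
      All.lookup (f[argmin]≤f[xs] e elements) (∈-filter⁺ (T? ∘ mem R) (∈-allD8 h) hR)

  classKey-≤ : ∀ f f' →
    (∀ h → T (mem R h) → Σ D8 λ h' → T (mem R h') × (∀ g → (f ⋆ h') g ≡ (f' ⋆ h) g)) →
    classKey f ≤ classKey f'
  classKey-≤ f f' cover with cover (representative f') (representative∈R f')
  ... | h' , h'R , f⋆h'≗f'⋆h = subst (classKey f ≤_)
    (trans (code-cong f⋆h'≗f'⋆h) (sym (classKey-representative f'))) (classKey-minimal f h'R)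

  classKey-cong : ∀ {f f'} → (∀ g → f g ≡ f' g) → classKey f ≡ classKey f'
  classKey-cong {f} {f'} f≗f' = ≤-antisym
    (classKey-≤ f f' λ h hR → h , hR , λ _ → f≗f' _)
    (classKey-≤ f' f λ h hR → h , hR , λ _ → sym (f≗f' _))

  classKey-⋆ : ∀ f {x} → T (mem R x) → classKey (f ⋆ x) ≡ classKey f
  classKey-⋆ f {x} xR = ≤-antisym
    (classKey-≤ (f ⋆ x) f λ h hR →
      x ⁻¹ ∙ h , mem-∙ R _ _ (mem-⁻¹ R x xR) hR ,
      λ g → trans (⋆-∙ f x (x ⁻¹ ∙ h) g) (cong (λ y → (f ⋆ y) g) (∙-⁻¹-cancelˡ x h)))
    (classKey-≤ f (f ⋆ x) λ h hR → x ∙ h , mem-∙ R _ _ xR hR , λ g → sym (⋆-∙ f x h g))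

-- Stabilisers of tile designs

module RSet {R : Subgroup} {k : ℕ} (A : TileSet R k) where
  open ClassKey R
  open ≡-Reasoning

  infixl 7 _·_
  _·_ : Fin k → D8 → Fin k
  _·_ = act A

  ·-∙ : ∀ t {g h} → T (mem R g) → T (mem R h) → t · (g ∙ h) ≡ t · g · h
  ·-∙ t {g} {h} = act-∙ A t g h

  ·-⁻¹ : ∀ t {g} → T (mem R g) → t · g · g ⁻¹ ≡ t
  ·-⁻¹ t {g} gR = begin
    t · g · g ⁻¹     ≡⟨ ·-∙ t gR (mem-⁻¹ R g gR) ⟨
    t · (g ∙ g ⁻¹)   ≡⟨ cong (t ·_) (∙-inverseʳ g) ⟩
    t · e            ≡⟨ act-e A t ⟩
    t                ∎

  ~-sym : ∀ {t t'} → DesignRel A t t' → DesignRel A t' t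
  ~-sym {t} (g , gR , refl) = g ⁻¹ , mem-⁻¹ R g gR , ·-⁻¹ t gR

  ~-trans : ∀ {t t' t''} → DesignRel A t t' → DesignRel A t' t'' → DesignRel A t t''
  ~-trans {t} (g , gR , refl) (h , hR , refl) = g ∙ h , mem-∙ R g h gR hR , ·-∙ t gR hR

  stab : Fin k → D8 → Bool
  stab t g = mem R g ∧ isYes (t · g ≟ᶠ t)

  stab⁺ : ∀ {t g} → T (mem R g) → t · g ≡ t → T (stab t g)
  stab⁺ {t} {g} gR tg≡t = Equivalence.from T-∧ (gR , fromWitness {a? = t · g ≟ᶠ t} tg≡t)

  stab⁻ : ∀ {t g} → T (stab t g) → T (mem R g) × t · g ≡ t
  stab⁻ {t} {g} p = let (gR , tg≡t) = Equivalence.to T-∧ p in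
    gR , toWitness {a? = t · g ≟ᶠ t} tg≡t

  stab-isSubgroupOf : ∀ t → IsSubgroupOf R (stab t)
  stab-isSubgroupOf t =
      stab⁺ (mem-e R) (act-e A t)
    , (λ g h p q → let (gR , tg≡t) = stab⁻ p ; (hR , th≡t) = stab⁻ q in
         stab⁺ (mem-∙ R g h gR hR) (trans (·-∙ t gR hR) (trans (cong (_· h) tg≡t) th≡t)))
    , (λ g p → let (gR , tg≡t) = stab⁻ p in
         stab⁺ (mem-⁻¹ R g gR) (trans (cong (_· g ⁻¹) (sym tg≡t)) (·-⁻¹ t gR)))
    , (λ g p → proj₁ (stab⁻ p))

  stab-· : ∀ t {x} → T (mem R x) → ∀ g → stab (t · x) g ≡ (stab t ⋆ x) g
  stab-· t {x} xR g = T-injective to from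
    where
    x⁻¹R = mem-⁻¹ R x xR
    to : T (stab (t · x) g) → T (stab t (x ∙ g ∙ x ⁻¹))
    to p = let (gR , txg≡tx) = stab⁻ p ; xgR = mem-∙ R x g xR gR in
      stab⁺ (mem-∙ R _ _ xgR x⁻¹R) (begin
        t · (x ∙ g ∙ x ⁻¹)   ≡⟨ ·-∙ t xgR x⁻¹R ⟩
        t · (x ∙ g) · x ⁻¹   ≡⟨ cong (_· x ⁻¹) (·-∙ t xR gR) ⟩
        t · x · g · x ⁻¹     ≡⟨ cong (_· x ⁻¹) txg≡tx ⟩
        t · x · x ⁻¹         ≡⟨ ·-⁻¹ t xR ⟩
        t                    ∎)
    from : T (stab t (x ∙ g ∙ x ⁻¹)) → T (stab (t · x) g)
    from p = let (cR , tc≡t) = stab⁻ p ; gR = g∈R cR in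
      stab⁺ gR (begin
        t · x · g                  ≡⟨ ·-∙ t xR gR ⟨
        t · (x ∙ g)                ≡⟨ cong (t ·_) (∙-⁻¹-cancelʳ (x ∙ g) x) ⟨
        t · (x ∙ g ∙ x ⁻¹ ∙ x)     ≡⟨ ·-∙ t cR xR ⟩
        t · (x ∙ g ∙ x ⁻¹) · x     ≡⟨ cong (_· x) tc≡t ⟩
        t · x                      ∎)
      where
      g∈R : T (mem R (x ∙ g ∙ x ⁻¹)) → T (mem R g)
      g∈R cR = subst (T ∘ mem R) (conj-cancelˡ x g) (mem-∙ R _ _ (mem-∙ R _ _ x⁻¹R cR) xR)

  ·-≡⇒stab : ∀ t {g h} → T (mem R g) → T (mem R h) → t · g ≡ t · h → T (stab t (g ∙ h ⁻¹))
  ·-≡⇒stab t {g} {h} gR hR tg≡th = stab⁺ (mem-∙ R g (h ⁻¹) gR h⁻¹R) (begin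
    t · (g ∙ h ⁻¹)   ≡⟨ ·-∙ t gR h⁻¹R ⟩
    t · g · h ⁻¹     ≡⟨ cong (_· h ⁻¹) tg≡th ⟩
    t · h · h ⁻¹     ≡⟨ ·-⁻¹ t hR ⟩
    t                ∎)
    where h⁻¹R = mem-⁻¹ R h hR

  stab⇒·-≡ : ∀ t {g h} → T (mem R h) → T (stab t (g ∙ h ⁻¹)) → t · g ≡ t · h
  stab⇒·-≡ t {g} {h} hR p = let (cR , tc≡t) = stab⁻ p in begin
    t · g                ≡⟨ cong (t ·_) (∙-⁻¹-cancelʳ g h) ⟨
    t · (g ∙ h ⁻¹ ∙ h)   ≡⟨ ·-∙ t cR hR ⟩
    t · (g ∙ h ⁻¹) · h   ≡⟨ cong (_· h) tc≡t ⟩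
    t · h                ∎

  stabConj⇒ : ∀ {S t} → StabConj A S t →
              Σ D8 λ h → T (mem R h) × (∀ g → stab (t · h) g ≡ mem S g)
  stabConj⇒ {S} {t} (h , hR , stab⇔S) = h , hR , λ g → begin
    stab (t · h) g                       ≡⟨ stab-· t hR g ⟩
    stab t (h ∙ g ∙ h ⁻¹)                ≡⟨ T-injective (proj₁ (stab⇔S _) ∘ stab⁻)
                                                        (uncurry stab⁺ ∘ proj₂ (stab⇔S _)) ⟩
    mem S (h ⁻¹ ∙ (h ∙ g ∙ h ⁻¹) ∙ h)    ≡⟨ cong (mem S) (conj-cancelˡ h g) ⟩
    mem S g                              ∎

  stabConj⇐ : ∀ {S t h} → T (mem R h) → (∀ g → stab (t · h) g ≡ mem S g) → StabConj A S t
  stabConj⇐ {S} {t} {h} hR stab≗S =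
    h , hR , λ g → subst T (stab≡ g) ∘ uncurry stab⁺ , stab⁻ ∘ subst T (sym (stab≡ g))
    where
    stab≡ : ∀ g → stab t g ≡ mem S (h ⁻¹ ∙ g ∙ h)
    stab≡ g = begin
      stab t g                             ≡⟨ cong (stab t) (conj-cancelʳ h g) ⟨
      stab t (h ∙ (h ⁻¹ ∙ g ∙ h) ∙ h ⁻¹)   ≡⟨ stab-· t hR _ ⟨
      stab (t · h) (h ⁻¹ ∙ g ∙ h)          ≡⟨ stab≗S _ ⟩
      mem S (h ⁻¹ ∙ g ∙ h)                 ∎

  key : Fin k → Code
  key t = classKey (stab t)

  key-· : ∀ t {x} → T (mem R x) → key (t · x) ≡ key t
  key-· t xR = trans (classKey-cong (stab-· t xR)) (classKey-⋆ (stab t) xR)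

  stabConj-key : ∀ t → StabConj A (canonicalSubgroup R (key t)) t
  stabConj-key t = stabConj⇐ {canonicalSubgroup R (key t)} hR λ g → sym (begin
    mem (canonicalSubgroup R (key t)) g  ≡⟨ mem-canonicalSubgroup R (key t) decode-isSubgroup g ⟩
    decode (key t) g                     ≡⟨ stab≗decode g ⟨
    stab (t · h) g                       ∎)
    where
    h = representative (stab t)
    hR = representative∈R (stab t)
    stab≗decode : ∀ g → stab (t · h) g ≡ decode (key t) g
    stab≗decode g = begin
      stab (t · h) g                     ≡⟨ stab-· t hR g ⟩
      (stab t ⋆ h) g                     ≡⟨ decode-code (stab t ⋆ h) g ⟨
      decode (code (stab t ⋆ h)) g       ≡⟨ cong (λ c → decode c g) (classKey-representative _) ⟨
      decode (key t) g                   ∎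
    decode-isSubgroup : IsSubgroupOf R (decode (key t))
    decode-isSubgroup = IsSubgroupOf-resp {R} stab≗decode (stab-isSubgroupOf (t · h))

  module Orbits {S : Subgroup} {N : ℕ} (orbits : OrbitCountWhere (DesignRel A) (StabConj A S) N)
    where

    rep : Fin N → Fin k
    rep = proj₁ orbits

    rep-injective : ∀ i j → DesignRel A (rep i) (rep j) → i ≡ j
    rep-injective = proj₁ (proj₂ orbits)

    rep-covers : ∀ t → StabConj A S t → Σ (Fin N) λ i → DesignRel A (rep i) t
    rep-covers = proj₂ (proj₂ (proj₂ orbits))

    private
      meets : ∀ i → Σ (Fin k) λ t → DesignRel A (rep i) t × StabConj A S t
      meets = proj₁ (proj₂ (proj₂ orbits))

    basepoint : Fin N → Fin k
    basepoint i = let (t , _ , sc) = meets i in t · proj₁ (stabConj⇒ {S} sc)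

    rep~basepoint : ∀ i → DesignRel A (rep i) (basepoint i)
    rep~basepoint i = let (t , rep~t , sc) = meets i ; (h , hR , _) = stabConj⇒ {S} sc in
      ~-trans rep~t (h , hR , refl)

    stab-basepoint : ∀ i g → stab (basepoint i) g ≡ mem S g
    stab-basepoint i = let (_ , _ , sc) = meets i in proj₂ (proj₂ (stabConj⇒ {S} sc))

-- Equivariant bijections between sets of tile designs

record _≅_ {R : Subgroup} {k k' : ℕ} (A : TileSet R k) (A' : TileSet R k') : Set where
  field
    to       : Fin k → Fin k'
    from     : Fin k' → Fin k
    to-act   : ∀ t g → T (mem R g) → to (act A t g) ≡ act A' (to t) g
    from-act : ∀ t g → T (mem R g) → from (act A' t g) ≡ act A (from t) g
    from-to  : ∀ t → from (to t) ≡ t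
    to-from  : ∀ t → to (from t) ≡ t

SameOrbitTypes-sym : ∀ {R k k'} {A : TileSet R k} {A' : TileSet R k'} →
                     SameOrbitTypes A A' → SameOrbitTypes A' A
SameOrbitTypes-sym same S S≤R =
  proj₁ (same S S≤R) , proj₂ (proj₂ (same S S≤R)) , proj₁ (proj₂ (same S S≤R))

-- The i-th orbit of type c in A, in the enumeration given by the hypothesis, is sent to the
-- i-th one in A' by basepoint · g ↦ basepoint' · g.
module Matching {R : Subgroup} {k k' : ℕ} (A : TileSet R k) (A' : TileSet R k')
                (same : SameOrbitTypes A A') where
  open RSet A
  open RSet A' using ()
    renaming (_·_ to _·'_; ·-∙ to ·'-∙; stab to stab'; stab-· to stab'-·; key to key';
              stab⇒·-≡ to stab'⇒·-≡; module Orbits to Orbits')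
  open ClassKey R using (classKey-cong)
  open ≡-Reasoning

  private
    S : Code → Subgroup
    S = canonicalSubgroup R

    N : Code → ℕ
    N c = proj₁ (same (S c) (canonicalSubgroup-≤ R c))

  module OfType  (c : Code) = Orbits  {S c} (proj₁ (proj₂ (same (S c) (canonicalSubgroup-≤ R c))))
  module OfType' (c : Code) = Orbits' {S c} (proj₂ (proj₂ (same (S c) (canonicalSubgroup-≤ R c))))
  open OfType  using (basepoint)
  open OfType' using () renaming (basepoint to basepoint')

  basepoint-transfer : ∀ c i j {g h} → T (mem R g) → T (mem R h) →
                       basepoint c i · g ≡ basepoint c j · h → basepoint' c i ·' g ≡ basepoint' c j ·' h
  basepoint-transfer c i j {g} {h} gR hR ig≡jh with OfType.rep-injective c i j rep-i~rep-j
    where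
    rep-i~rep-j : DesignRel A (OfType.rep c i) (OfType.rep c j)
    rep-i~rep-j = ~-trans (OfType.rep~basepoint c i)
                    (~-trans (g , gR , ig≡jh) (~-sym (~-trans (OfType.rep~basepoint c j) (h , hR , refl))))
  ... | refl =
    stab'⇒·-≡ (basepoint' c i) hR (subst T (sym stab≡) (·-≡⇒stab (basepoint c i) gR hR ig≡jh))
    where
    stab≡ : stab' (basepoint' c i) (g ∙ h ⁻¹) ≡ stab (basepoint c i) (g ∙ h ⁻¹)
    stab≡ = trans (OfType'.stab-basepoint c i _) (sym (OfType.stab-basepoint c i _))

  opaque
    orbitIndex : (t : Fin k) → Fin (N (key t))
    orbitIndex t = proj₁ (OfType.rep-covers (key t) t (stabConj-key t))

    basepoint~ : ∀ t → DesignRel A (basepoint (key t) (orbitIndex t)) t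
    basepoint~ t = ~-trans (~-sym (OfType.rep~basepoint (key t) (orbitIndex t)))
                           (proj₂ (OfType.rep-covers (key t) t (stabConj-key t)))

    φ : Fin k → Fin k'
    φ t = basepoint' (key t) (orbitIndex t) ·' proj₁ (basepoint~ t)

    φ-char : ∀ {t c} → key t ≡ c → ∀ i {g} → T (mem R g) →
             basepoint c i · g ≡ t → φ t ≡ basepoint' c i ·' g
    φ-char {t} refl i gR ig≡t = let (g₀ , g₀R , ig₀≡t) = basepoint~ t in
      basepoint-transfer (key t) (orbitIndex t) i g₀R gR (trans ig₀≡t (sym ig≡t))

  φ-act : ∀ t g → T (mem R g) → φ (t · g) ≡ φ t ·' g
  φ-act t x xR = let (g , gR , ig≡t) = basepoint~ t ; c = key t ; i = orbitIndex t in begin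
    φ (t · x)                    ≡⟨ φ-char (key-· t xR) i (mem-∙ R g x gR xR)
                                     (trans (·-∙ (basepoint c i) gR xR) (cong (_· x) ig≡t)) ⟩
    basepoint' c i ·' (g ∙ x)    ≡⟨ ·'-∙ (basepoint' c i) gR xR ⟩
    basepoint' c i ·' g ·' x     ≡⟨ cong (_·' x) (φ-char refl i gR ig≡t) ⟨
    φ t ·' x                     ∎

  key-φ : ∀ t → key' (φ t) ≡ key t
  key-φ t = classKey-cong stab≗
    where
    stab≗ : ∀ x → stab' (φ t) x ≡ stab t x
    stab≗ x = let (g , gR , ig≡t) = basepoint~ t ; c = key t ; i = orbitIndex t in begin
      stab' (φ t) x                         ≡⟨ cong (λ u → stab' u x) (φ-char refl i gR ig≡t) ⟩
      stab' (basepoint' c i ·' g) x         ≡⟨ stab'-· (basepoint' c i) gR x ⟩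
      stab' (basepoint' c i) (g ∙ x ∙ g ⁻¹) ≡⟨ OfType'.stab-basepoint c i _ ⟩
      mem (S c) (g ∙ x ∙ g ⁻¹)              ≡⟨ OfType.stab-basepoint c i _ ⟨
      stab (basepoint c i) (g ∙ x ∙ g ⁻¹)   ≡⟨ stab-· (basepoint c i) gR x ⟨
      stab (basepoint c i · g) x            ≡⟨ cong (λ t → stab t x) ig≡t ⟩
      stab t x                              ∎

φ-retraction : ∀ {R k k'} {A : TileSet R k} {A' : TileSet R k'} (same : SameOrbitTypes A A') t →
               Matching.φ A' A (SameOrbitTypes-sym {A = A} {A'} same) (Matching.φ A A' same t) ≡ t
φ-retraction {A = A} {A'} same t = let (g , gR , ig≡t) = M.basepoint~ t ; i = M.orbitIndex t in
  trans (M'.φ-char (M.key-φ t) i gR (sym (M.φ-char refl i gR ig≡t))) ig≡t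
  where
  -- M' reads the same enumerations with A and A' swapped, so its basepoints are those of M.
  module M  = Matching A A' same
  module M' = Matching A' A (SameOrbitTypes-sym {A = A} {A'} same)

sameOrbitTypes⇒≅ : ∀ {R k k'} {A : TileSet R k} {A' : TileSet R k'} → SameOrbitTypes A A' → A ≅ A'
sameOrbitTypes⇒≅ {A = A} {A'} same = record
  { to       = Matching.φ A A' same
  ; from     = Matching.φ A' A same⁻¹
  ; to-act   = Matching.φ-act A A' same
  ; from-act = Matching.φ-act A' A same⁻¹
  ; from-to  = φ-retraction same
  ; to-from  = φ-retraction same⁻¹
  }
  where
  same⁻¹ : SameOrbitTypes A' A
  same⁻¹ = SameOrbitTypes-sym {A = A} {A'} same

-- Counting orbits of tilings

module Greedy (S : Setoid 0ℓ 0ℓ) {_~_ : Setoid.Carrier S → Setoid.Carrier S → Set}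
              (_~?_ : Decidable₂ _~_) (~-refl : ∀ x → x ~ x) (~-sym : Symmetric _~_)
              (~-respʳ : _~_ Respectsʳ Setoid._≈_ S) where
  open Setoid S using () renaming (Carrier to X; sym to ≈-sym)
  open import Data.List.Membership.Setoid S using () renaming (_∈_ to _∈ₛ_)

  -- Every dropped element is related to a kept one.
  representatives : List X → List X
  representatives [] = []
  representatives (x ∷ xs) with Any.any? (_~? x) (representatives xs)
  ... | yes _ = representatives xs
  ... | no _  = x ∷ representatives xs

  Distinct : List X → Set
  Distinct ys = ∀ i j → lookup ys i ~ lookup ys j → i ≡ j

  ∷-distinct : ∀ {x ys} → ¬ Any (_~ x) ys → Distinct ys → Distinct (x ∷ ys)
  ∷-distinct _  _ zero    zero    _    = refl
  ∷-distinct x≁ _ zero    (suc j) x~y  = ⊥-elim (x≁ (lose (∈-lookup j) (~-sym x~y)))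
  ∷-distinct x≁ _ (suc i) zero    y~x  = ⊥-elim (x≁ (lose (∈-lookup i) y~x))
  ∷-distinct _  d (suc i) (suc j) y~y' = cong suc (d i j y~y')

  representatives-distinct : ∀ xs → Distinct (representatives xs)
  representatives-distinct [] ()
  representatives-distinct (x ∷ xs) with Any.any? (_~? x) (representatives xs)
  ... | yes _ = representatives-distinct xs
  ... | no x≁ = ∷-distinct x≁ (representatives-distinct xs)

  representatives-cover : ∀ {x} xs → x ∈ₛ xs → Any (_~ x) (representatives xs)
  representatives-cover (y ∷ xs) (here x≈y) with Any.any? (_~? y) (representatives xs)
  ... | yes r~y = Any.map (~-respʳ (≈-sym x≈y)) r~y
  ... | no _    = here (~-respʳ (≈-sym x≈y) (~-refl y))
  representatives-cover (y ∷ xs) (there x∈xs) with Any.any? (_~? y) (representatives xs)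
  ... | yes _ = representatives-cover xs x∈xs
  ... | no _  = there (representatives-cover xs x∈xs)

  orbitCount : ∀ {xs} → IsEnumeration S xs → Σ ℕ (OrbitCount _~_)
  orbitCount {xs} enum =
      length (representatives xs)
    , lookup (representatives xs)
    , representatives-distinct xs
    , (λ i → _ , ~-refl _ , tt)
    , λ x _ → let r~x = representatives-cover xs (enum x) in Any.index r~x , lookup-result r~x

functions : {B : Set} → List B → (n : ℕ) → List (Fin n → B)
functions bs ℕ.zero  = [ Vector.[] ]
functions bs (suc n) = cartesianProductWith Vector._∷_ bs (functions bs n)

functions-enumerate : ∀ {B : Set} {bs : List B} → (∀ b → b ∈ bs) →
                      ∀ n → IsEnumeration (Fin n →-setoid B) (functions bs n)
functions-enumerate _ ℕ.zero f = here (λ ())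
functions-enumerate {B} {bs} bs-enum (suc n) f =
  Setoidᴹ.∈-resp-≈ (Fin (suc n) →-setoid B) head∷tail≗f
    (Setoidᴹ.∈-cartesianProductWith⁺ (setoid B) (Fin n →-setoid B) (Fin (suc n) →-setoid B)
      ∷-cong (bs-enum (f zero)) (functions-enumerate bs-enum n (f ∘ suc)))
  where
  ∷-cong : ∀ {b b'} {g g' : Fin n → B} → b ≡ b' → (∀ i → g i ≡ g' i) →
           ∀ i → (b Vector.∷ g) i ≡ (b' Vector.∷ g') i
  ∷-cong b≡b' _    zero    = b≡b'
  ∷-cong _    g≗g' (suc i) = g≗g' i
  head∷tail≗f : ∀ i → (f zero Vector.∷ f ∘ suc) i ≡ f i
  head∷tail≗f zero    = refl
  head∷tail≗f (suc i) = refl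

tilings : (n m k : ℕ) → List (Cell n m → Fin k)
tilings n m k = map (λ f (x , y) → f (combine x y)) (functions (allFin k) (n * m))

tilings-enumerate : ∀ n m k → IsEnumeration (Cell n m →-setoid Fin k) (tilings n m k)
tilings-enumerate n m k τ =
  Setoidᴹ.∈-resp-≈ (Cell n m →-setoid Fin k) (λ (x , y) → cong τ (remQuot-combine x y))
    (Setoidᴹ.∈-map⁺ (Fin (n * m) →-setoid Fin k) (Cell n m →-setoid Fin k)
      (λ f≗g (x , y) → f≗g (combine x y))
      (functions-enumerate ∈-allFin (n * m) (τ ∘ remQuot m)))

allCells? : ∀ {n m} {P : Cell n m → Set} → Decidable P → Dec (∀ c → P c)
allCells? P? = map′ (λ p (x , y) → p x y) (λ p x y → p (x , y))
                    (allFin? λ x → allFin? λ y → P? (x , y))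

-- The arguments of a TilingRel, with what makes it the orbit relation of a finite group action.
record Symmetries (R : Subgroup) (C : Set) : Set₁ where
  field
    Sym           : Set
    ok            : Sym → Set
    lbl           : Sym → D8
    cact          : (s : Sym) → ok s → C → C
    ok?           : ∀ s → Dec (ok s)
    ok-irrelevant : ∀ {s} (o o' : ok s) → o ≡ o'
    search        : {P : Sym → Set} → Decidable P → Dec (Σ Sym P)
    lbl∈R         : ∀ s → ok s → T (mem R (lbl s))
    identity      : Σ Sym λ s → Σ (ok s) λ o → lbl s ≡ e × (∀ c → cact s o c ≡ c)
    inverse       : ∀ s o → Σ Sym λ s' → Σ (ok s') λ o' →
                      lbl s' ≡ lbl s ⁻¹ × (∀ c → cact s o (cact s' o' c) ≡ c)

  Rel : ∀ {k} → TileSet R k → (C → Fin k) → (C → Fin k) → Set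
  Rel A = TilingRel ok lbl cact (act A)

  module _ {k} (A : TileSet R k) where
    open RSet A using (_·_; ·-⁻¹)
    open ≡-Reasoning

    Rel-refl : ∀ τ → Rel A τ τ
    Rel-refl τ = let (s , o , s≡e , s≗id) = identity in s , o , λ c → begin
      τ (cact s o c)   ≡⟨ cong τ (s≗id c) ⟩
      τ c              ≡⟨ act-e A (τ c) ⟨
      τ c · e          ≡⟨ cong (τ c ·_) s≡e ⟨
      τ c · lbl s      ∎

    Rel-sym : ∀ {τ τ'} → Rel A τ τ' → Rel A τ' τ
    Rel-sym {τ} {τ'} (s , o , τ'≡τ·s) = let (s' , o' , s'≡s⁻¹ , s∘s'≗id) = inverse s o in
      s' , o' , λ c → let d = cact s' o' c in begin
      τ d                             ≡⟨ ·-⁻¹ (τ d) (lbl∈R s o) ⟨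
      τ d · lbl s · lbl s ⁻¹          ≡⟨ cong (_· lbl s ⁻¹) (τ'≡τ·s d) ⟨
      τ' (cact s o d) · lbl s ⁻¹      ≡⟨ cong₂ (λ c g → τ' c · g) (s∘s'≗id c) (sym s'≡s⁻¹) ⟩
      τ' c · lbl s'                   ∎

    Rel-respˡ : ∀ {τ τ' τ''} → (∀ c → τ c ≡ τ'' c) → Rel A τ τ' → Rel A τ'' τ'
    Rel-respˡ τ≗τ'' (s , o , p) = s , o , λ c → trans (p c) (cong (_· lbl s) (τ≗τ'' c))

    Rel-respʳ : ∀ {τ τ' τ''} → (∀ c → τ' c ≡ τ'' c) → Rel A τ τ' → Rel A τ τ''
    Rel-respʳ τ'≗τ'' (s , o , p) = s , o , λ c → trans (sym (τ'≗τ'' _)) (p c)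

    Rel? : ({P : C → Set} → Decidable P → Dec (∀ c → P c)) → ∀ τ τ' → Dec (Rel A τ τ')
    Rel? allC? τ τ' = search witness?
      where
      Matches : ∀ s → ok s → Set
      Matches s o = ∀ c → τ' (cact s o c) ≡ τ c · lbl s
      witness? : ∀ s → Dec (Σ (ok s) (Matches s))
      witness? s with ok? s
      ... | no ¬o = no (¬o ∘ proj₁)
      ... | yes o = map′ (o ,_) (λ (o' , p) → subst (Matches s) (ok-irrelevant o' o) p)
                         (allC? λ c → τ' (cact s o c) ≟ᶠ τ c · lbl s)

  Rel-map : ∀ {k k'} (A : TileSet R k) (A' : TileSet R k') (φ : Fin k → Fin k') →
            (∀ t g → T (mem R g) → φ (act A t g) ≡ act A' (φ t) g) →
            ∀ {τ τ'} → Rel A τ τ' → Rel A' (φ ∘ τ) (φ ∘ τ')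
  Rel-map A A' φ φ-act (s , o , p) = s , o , λ c → trans (cong φ (p c)) (φ-act _ _ (lbl∈R s o))

  orbitCount-≅ : ∀ {k k' N} {A : TileSet R k} {A' : TileSet R k'} →
                 A ≅ A' → OrbitCount (Rel A) N → OrbitCount (Rel A') N
  orbitCount-≅ {A = A} {A'} A≅A' (reps , injective , _ , covers) =
      (λ i → to ∘ reps i)
    , (λ i j r → injective i j
         (Rel-respˡ A {from ∘ to ∘ reps i} {reps j} (from-to ∘ reps i)
           (Rel-respʳ A {τ' = from ∘ to ∘ reps j} (from-to ∘ reps j)
             (Rel-map A' A from from-act {to ∘ reps i} {to ∘ reps j} r))))
    , (λ i → to ∘ reps i , Rel-refl A' (to ∘ reps i) , tt)
    , λ τ _ → let (i , r) = covers (from ∘ τ) tt in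
        i , Rel-respʳ A' {τ' = to ∘ from ∘ τ} (to-from ∘ τ)
              (Rel-map A A' to to-act {reps i} {from ∘ τ} r)
    where open _≅_ A≅A'

module _ {R : Subgroup} {n m : ℕ} (F : Symmetries R (Cell n m)) where
  open Symmetries F

  tilingOrbitCount : ∀ {k} (A : TileSet R k) → Σ ℕ (OrbitCount (Rel A))
  tilingOrbitCount {k} A =
    Greedy.orbitCount (Cell n m →-setoid Fin k)
      (Rel? A allCells?) (Rel-refl A) (Rel-sym A) (Rel-respʳ A) (tilings-enumerate n m k)

  sameOrbitCount : ∀ {k k'} (A : TileSet R k) (A' : TileSet R k') →
                   SameOrbitTypes A A' → SameOrbitCount (Rel A) (Rel A')
  sameOrbitCount A A' same = let (N , count) = tilingOrbitCount A in
    N , count , orbitCount-≅ (sameOrbitTypes⇒≅ {A = A} {A'} same) count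

-- Symmetries of the grid, the cylinder and the torus

module _ {n : ℕ} .{{_ : NonZero n}} where
  open ≡-Reasoning

  infix 21 ⊖_
  ⊖_ : Fin n → Fin n
  ⊖ a = (n ∸ toℕ a) mod n

  toℕ-⊕ : ∀ (x a : Fin n) → toℕ (x ⊕ a) ≡ (toℕ x + toℕ a) % n
  toℕ-⊕ x a = toℕ-fromℕ< _

  [m%n+k]%n≡[m+k]%n : ∀ p q → (p % n + q) % n ≡ (p + q) % n
  [m%n+k]%n≡[m+k]%n p q = begin
    (p % n + q) % n           ≡⟨ %-distribˡ-+ (p % n) q n ⟩
    (p % n % n + q % n) % n   ≡⟨ cong (λ r → (r + q % n) % n) (m%n%n≡m%n p n) ⟩
    (p % n + q % n) % n       ≡⟨ %-distribˡ-+ p q n ⟨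
    (p + q) % n               ∎

  ⊖-⊕-cancel : ∀ (x a : Fin n) → (x ⊕ ⊖ a) ⊕ a ≡ x
  ⊖-⊕-cancel x a = toℕ-injective (begin
    toℕ ((x ⊕ ⊖ a) ⊕ a)                ≡⟨ toℕ-⊕ (x ⊕ ⊖ a) a ⟩
    (toℕ (x ⊕ ⊖ a) + A) % n            ≡⟨ cong (λ r → (r + A) % n) (toℕ-⊕ x (⊖ a)) ⟩
    ((X + toℕ (⊖ a)) % n + A) % n      ≡⟨ [m%n+k]%n≡[m+k]%n (X + toℕ (⊖ a)) A ⟩
    (X + toℕ (⊖ a) + A) % n            ≡⟨ cong (λ r → (X + r + A) % n) (toℕ-fromℕ< _) ⟩
    (X + (n ∸ A) % n + A) % n          ≡⟨ cong (_% n) (shuffle X ((n ∸ A) % n) A) ⟩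
    ((n ∸ A) % n + (X + A)) % n        ≡⟨ [m%n+k]%n≡[m+k]%n (n ∸ A) (X + A) ⟩
    ((n ∸ A) + (X + A)) % n            ≡⟨ cong (_% n) (exchange (n ∸ A) X A) ⟩
    (X + ((n ∸ A) + A)) % n            ≡⟨ cong (λ r → (X + r) % n) (m∸n+n≡m (<⇒≤ (toℕ<n a))) ⟩
    (X + n) % n                        ≡⟨ [m+n]%n≡m%n X n ⟩
    X % n                              ≡⟨ m<n⇒m%n≡m (toℕ<n x) ⟩
    X                                  ∎)
    where
    X = toℕ x
    A = toℕ a
    shuffle : ∀ p q r → p + q + r ≡ q + (p + r)
    shuffle = solve-∀
    exchange : ∀ p q r → p + (q + r) ≡ q + (p + r)
    exchange = solve-∀

  opposite-⊕ : ∀ (x a : Fin n) → opposite (x ⊕ a) ⊕ a ≡ opposite x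
  opposite-⊕ x a = toℕ-injective (begin
    toℕ (opposite (x ⊕ a) ⊕ a)         ≡⟨ toℕ-⊕ (opposite (x ⊕ a)) a ⟩
    (toℕ (opposite (x ⊕ a)) + A) % n   ≡⟨ cong (λ r → (r + A) % n) (opposite-prop (x ⊕ a)) ⟩
    (n ∸ suc W + A) % n                ≡⟨ cong (_% n) (+-cancelʳ-≡ (suc X) _ _ add-suc-X) ⟩
    (n ∸ suc X + q * n) % n            ≡⟨ [m+kn]%n≡m%n (n ∸ suc X) q n ⟩
    (n ∸ suc X) % n                    ≡⟨ cong (_% n) (opposite-prop x) ⟨
    toℕ (opposite x) % n               ≡⟨ m<n⇒m%n≡m (toℕ<n (opposite x)) ⟩
    toℕ (opposite x)                   ∎)
    where
    X = toℕ x
    A = toℕ a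
    W = toℕ (x ⊕ a)
    q = (X + A) / n
    X+A≡W+q*n : X + A ≡ W + q * n
    X+A≡W+q*n = trans (m≡m%n+[m/n]*n (X + A) n) (cong (_+ q * n) (sym (toℕ-⊕ x a)))
    shift : ∀ p a x → p + a + suc x ≡ p + suc (x + a)
    shift = solve-∀
    regroup : ∀ p w r → p + suc (w + r) ≡ p + suc w + r
    regroup = solve-∀
    swap : ∀ p s r → p + s + r ≡ p + r + s
    swap = solve-∀
    add-suc-X : n ∸ suc W + A + suc X ≡ n ∸ suc X + q * n + suc X
    add-suc-X = begin
      n ∸ suc W + A + suc X         ≡⟨ shift (n ∸ suc W) A X ⟩
      n ∸ suc W + suc (X + A)       ≡⟨ cong (λ r → n ∸ suc W + suc r) X+A≡W+q*n ⟩
      n ∸ suc W + suc (W + q * n)   ≡⟨ regroup (n ∸ suc W) W (q * n) ⟩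
      n ∸ suc W + suc W + q * n     ≡⟨ cong (_+ q * n) (m∸n+n≡m (toℕ<n (x ⊕ a))) ⟩
      n + q * n                     ≡⟨ cong (_+ q * n) (m∸n+n≡m (toℕ<n x)) ⟨
      n ∸ suc X + suc X + q * n     ≡⟨ swap (n ∸ suc X) (suc X) (q * n) ⟩
      n ∸ suc X + q * n + suc X     ∎

  opposite-⊕-involutive : ∀ (x a : Fin n) → opposite (opposite (x ⊕ a) ⊕ a) ≡ x
  opposite-⊕-involutive x a = trans (cong opposite (opposite-⊕ x a)) (opposite-involutive x)

  opposite²-⊖-⊕-cancel : ∀ (x a : Fin n) →
                         opposite (opposite (opposite (opposite (x ⊕ ⊖ a)) ⊕ a)) ≡ x
  opposite²-⊖-⊕-cancel x a =
    trans (opposite-involutive _) (trans (cong (_⊕ a) (opposite-involutive _)) (⊖-⊕-cancel x a))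

⊕-identityʳ : ∀ {n} (x : Fin (suc n)) → x ⊕ zero ≡ x
⊕-identityʳ {n} x = toℕ-injective (begin
  toℕ (x ⊕ zero)        ≡⟨ toℕ-⊕ x zero ⟩
  (toℕ x + 0) % suc n   ≡⟨ cong (_% suc n) (+-identityʳ (toℕ x)) ⟩
  toℕ x % suc n         ≡⟨ m<n⇒m%n≡m (toℕ<n x) ⟩
  toℕ x                 ∎)
  where open ≡-Reasoning

isD4? : ∀ g → Dec (IsD4 g)
isD4? (mkD8 ρ0 b) = yes (d0 b)
isD4? (mkD8 ρ1 _) = no λ ()
isD4? (mkD8 ρ2 b) = yes (d2 b)
isD4? (mkD8 ρ3 _) = no λ ()

IsD4-irrelevant : ∀ {g} (d d' : IsD4 g) → d ≡ d'
IsD4-irrelevant (d0 _) (d0 _) = refl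
IsD4-irrelevant (d2 _) (d2 _) = refl

IsD4⇒self-inverse : ∀ {g} → IsD4 g → g ≡ g ⁻¹
IsD4⇒self-inverse (d0 false) = refl
IsD4⇒self-inverse (d0 true)  = refl
IsD4⇒self-inverse (d2 false) = refl
IsD4⇒self-inverse (d2 true)  = refl

cellAct4-involutive : ∀ {n m g} (d : IsD4 g) (c : Cell n m) → cellAct4 g d (cellAct4 g d c) ≡ c
cellAct4-involutive (d0 false) _       = refl
cellAct4-involutive (d0 true)  (x , y) = cong (_, y) (opposite-involutive x)
cellAct4-involutive (d2 false) (x , y) = cong₂ _,_ (opposite-involutive x) (opposite-involutive y)
cellAct4-involutive (d2 true)  (x , y) =
  cong₂ _,_ (trans (opposite-involutive _) (opposite-involutive x)) (opposite-involutive y)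

cellAct8-inverse : ∀ {n} g (c : Cell n n) → cellAct8 g (cellAct8 (g ⁻¹) c) ≡ c
cellAct8-inverse (mkD8 ρ0 false) _       = refl
cellAct8-inverse (mkD8 ρ1 false) (x , y) = cong (_, y) (opposite-involutive x)
cellAct8-inverse (mkD8 ρ2 false) (x , y) = cong₂ _,_ (opposite-involutive x) (opposite-involutive y)
cellAct8-inverse (mkD8 ρ3 false) (x , y) = cong (x ,_) (opposite-involutive y)
cellAct8-inverse (mkD8 ρ0 true)  (x , y) = cong (_, y) (opposite-involutive x)
cellAct8-inverse (mkD8 ρ1 true)  (x , y) = cong₂ _,_ (opposite-involutive x) (opposite-involutive y)
cellAct8-inverse (mkD8 ρ2 true)  (x , y) =
  cong₂ _,_ (trans (opposite-involutive _) (opposite-involutive x)) (opposite-involutive y)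
cellAct8-inverse (mkD8 ρ3 true)  (x , y) = cong₂ _,_ (opposite-involutive x) (opposite-involutive y)

cylinderAct : ∀ {n m} .{{_ : NonZero n}} → Fin n → (g : D8) → IsD4 g → Cell n m → Cell n m
cylinderAct a g d (x , y) = cellAct4 g d (x ⊕ a , y)

cylinderAct-inverse : ∀ {n m g} .{{_ : NonZero n}} (a : Fin n) (d : IsD4 g) →
                      Σ (Fin n) λ a' → ∀ (c : Cell n m) →
                        cylinderAct a g d (cylinderAct a' g d c) ≡ c
cylinderAct-inverse a (d0 false) = ⊖ a , λ (x , y) → cong (_, y) (⊖-⊕-cancel x a)
cylinderAct-inverse a (d0 true)  = a   , λ (x , y) → cong (_, y) (opposite-⊕-involutive x a)
cylinderAct-inverse a (d2 false) =
  a , λ (x , y) → cong₂ _,_ (opposite-⊕-involutive x a) (opposite-involutive y)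
cylinderAct-inverse a (d2 true) =
  ⊖ a , λ (x , y) → cong₂ _,_ (opposite²-⊖-⊕-cancel x a) (opposite-involutive y)

torusAct4 : ∀ {n m} .{{_ : NonZero n}} .{{_ : NonZero m}} →
            Fin n × Fin m → (g : D8) → IsD4 g → Cell n m → Cell n m
torusAct4 (a , b) g d (x , y) = cellAct4 g d (x ⊕ a , y ⊕ b)

torusAct4-inverse : ∀ {n m g} .{{_ : NonZero n}} .{{_ : NonZero m}}
                    (v : Fin n × Fin m) (d : IsD4 g) →
                    Σ (Fin n × Fin m) λ v' → ∀ c → torusAct4 v g d (torusAct4 v' g d c) ≡ c
torusAct4-inverse (a , b) (d0 false) =
  (⊖ a , ⊖ b) , λ (x , y) → cong₂ _,_ (⊖-⊕-cancel x a) (⊖-⊕-cancel y b)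
torusAct4-inverse (a , b) (d0 true) =
  (a , ⊖ b) , λ (x , y) → cong₂ _,_ (opposite-⊕-involutive x a) (⊖-⊕-cancel y b)
torusAct4-inverse (a , b) (d2 false) =
  (a , b) , λ (x , y) → cong₂ _,_ (opposite-⊕-involutive x a) (opposite-⊕-involutive y b)
torusAct4-inverse (a , b) (d2 true) =
  (⊖ a , b) , λ (x , y) → cong₂ _,_ (opposite²-⊖-⊕-cancel x a) (opposite-⊕-involutive y b)

torusAct8 : ∀ {n} .{{_ : NonZero n}} → Fin n × Fin n → D8 → Cell n n → Cell n n
torusAct8 (a , b) g (x , y) = cellAct8 g (x ⊕ a , y ⊕ b)

torusAct8-inverse : ∀ {n} .{{_ : NonZero n}} (v : Fin n × Fin n) g →
                    Σ (Fin n × Fin n) λ v' → ∀ c → torusAct8 v g (torusAct8 v' (g ⁻¹) c) ≡ c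
torusAct8-inverse (a , b) (mkD8 ρ0 false) =
  (⊖ a , ⊖ b) , λ (x , y) → cong₂ _,_ (⊖-⊕-cancel x a) (⊖-⊕-cancel y b)
torusAct8-inverse (a , b) (mkD8 ρ1 false) =
  (b , ⊖ a) , λ (x , y) → cong₂ _,_ (opposite-⊕-involutive x b) (⊖-⊕-cancel y a)
torusAct8-inverse (a , b) (mkD8 ρ2 false) =
  (a , b) , λ (x , y) → cong₂ _,_ (opposite-⊕-involutive x a) (opposite-⊕-involutive y b)
torusAct8-inverse (a , b) (mkD8 ρ3 false) =
  (⊖ b , a) , λ (x , y) → cong₂ _,_ (⊖-⊕-cancel x b) (opposite-⊕-involutive y a)
torusAct8-inverse (a , b) (mkD8 ρ0 true) =
  (a , ⊖ b) , λ (x , y) → cong₂ _,_ (opposite-⊕-involutive x a) (⊖-⊕-cancel y b)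
torusAct8-inverse (a , b) (mkD8 ρ1 true) =
  (⊖ b , ⊖ a) , λ (x , y) → cong₂ _,_ (trans (opposite-involutive _) (⊖-⊕-cancel x b))
                                      (trans (cong (_⊕ a) (opposite-involutive _)) (⊖-⊕-cancel y a))
torusAct8-inverse (a , b) (mkD8 ρ2 true) =
  (⊖ a , b) , λ (x , y) → cong₂ _,_ (opposite²-⊖-⊕-cancel x a) (opposite-⊕-involutive y b)
torusAct8-inverse (a , b) (mkD8 ρ3 true) =
  (b , a) , λ (x , y) → cong₂ _,_ (opposite-⊕-involutive x b) (opposite-⊕-involutive y a)

search-× : ∀ {A B : Set} →
           ({P : A → Set} → Decidable P → Dec (Σ A P)) →
           ({Q : B → Set} → Decidable Q → Dec (Σ B Q)) →
           {P : A × B → Set} → Decidable P → Dec (Σ (A × B) P)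
search-× searchA searchB P? = map′ (λ (a , b , p) → (a , b) , p) (λ ((a , b) , p) → a , b , p)
                                   (searchA λ a → searchB λ b → P? (a , b))

module _ (R : Subgroup) where

  InR∩D4 : D8 → Set
  InR∩D4 g = T (mem R g) × IsD4 g

  inR∩D4? : ∀ g → Dec (InR∩D4 g)
  inR∩D4? g = T? (mem R g) ×-dec isD4? g

  InR∩D4-irrelevant : ∀ {g} (o o' : InR∩D4 g) → o ≡ o'
  InR∩D4-irrelevant (gR , d) (gR' , d') = cong₂ _,_ (T-irrelevant gR gR') (IsD4-irrelevant d d')

  grid4 : (n m : ℕ) → Symmetries R (Cell n m)
  grid4 n m = record
    { Sym           = D8
    ; ok            = InR∩D4
    ; lbl           = λ g → g
    ; cact          = λ g (_ , d) → cellAct4 g d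
    ; ok?           = inR∩D4?
    ; ok-irrelevant = InR∩D4-irrelevant
    ; search        = any?
    ; lbl∈R         = λ _ → proj₁
    ; identity      = e , (mem-e R , d0 false) , refl , λ _ → refl
    ; inverse       = λ g (gR , d) → g , (gR , d) , IsD4⇒self-inverse d , cellAct4-involutive d
    }

  cylinder : (n m : ℕ) → Symmetries R (Cell (suc n) m)
  cylinder n m = record
    { Sym           = Fin (suc n) × D8
    ; ok            = λ (_ , g) → InR∩D4 g
    ; lbl           = proj₂
    ; cact          = λ (a , g) (_ , d) → cylinderAct a g d
    ; ok?           = λ (_ , g) → inR∩D4? g
    ; ok-irrelevant = InR∩D4-irrelevant
    ; search        = search-× anyFin? any?
    ; lbl∈R         = λ _ → proj₁
    ; identity      = (zero , e) , (mem-e R , d0 false) , refl ,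
                      λ (x , y) → cong (_, y) (⊕-identityʳ x)
    ; inverse       = λ (a , g) (gR , d) → let (a' , cancel) = cylinderAct-inverse a d in
                        (a' , g) , (gR , d) , IsD4⇒self-inverse d , cancel
    }

  torus4 : (n m : ℕ) → Symmetries R (Cell (suc n) (suc m))
  torus4 n m = record
    { Sym           = (Fin (suc n) × Fin (suc m)) × D8
    ; ok            = λ (_ , g) → InR∩D4 g
    ; lbl           = proj₂
    ; cact          = λ (v , g) (_ , d) → torusAct4 v g d
    ; ok?           = λ (_ , g) → inR∩D4? g
    ; ok-irrelevant = InR∩D4-irrelevant
    ; search        = search-× (search-× anyFin? anyFin?) any?
    ; lbl∈R         = λ _ → proj₁
    ; identity      = ((zero , zero) , e) , (mem-e R , d0 false) , refl ,
                      λ (x , y) → cong₂ _,_ (⊕-identityʳ x) (⊕-identityʳ y)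
    ; inverse       = λ (v , g) (gR , d) → let (v' , cancel) = torusAct4-inverse v d in
                        (v' , g) , (gR , d) , IsD4⇒self-inverse d , cancel
    }

  grid8 : (n : ℕ) → Symmetries R (Cell n n)
  grid8 n = record
    { Sym           = D8
    ; ok            = T ∘ mem R
    ; lbl           = λ g → g
    ; cact          = λ g _ → cellAct8 g
    ; ok?           = T? ∘ mem R
    ; ok-irrelevant = T-irrelevant
    ; search        = any?
    ; lbl∈R         = λ _ gR → gR
    ; identity      = e , mem-e R , refl , λ _ → refl
    ; inverse       = λ g gR → g ⁻¹ , mem-⁻¹ R g gR , refl , cellAct8-inverse g
    }

  torus8 : (n : ℕ) → Symmetries R (Cell (suc n) (suc n))
  torus8 n = record
    { Sym           = (Fin (suc n) × Fin (suc n)) × D8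
    ; ok            = λ (_ , g) → T (mem R g)
    ; lbl           = proj₂
    ; cact          = λ (v , g) _ → torusAct8 v g
    ; ok?           = λ (_ , g) → T? (mem R g)
    ; ok-irrelevant = T-irrelevant
    ; search        = search-× (search-× anyFin? anyFin?) any?
    ; lbl∈R         = λ _ gR → gR
    ; identity      = ((zero , zero) , e) , mem-e R , refl ,
                      λ (x , y) → cong₂ _,_ (⊕-identityʳ x) (⊕-identityʳ y)
    ; inverse       = λ (v , g) gR → let (v' , cancel) = torusAct8-inverse v g in
                        (v' , g ⁻¹) , mem-⁻¹ R g gR , refl , cancel
    }

mainTheorem1 :
    ((n m : ℕ) .{{_ : NonZero n}} .{{_ : NonZero m}} →
     (R : Subgroup) → InD4 R →
     {k k' : ℕ} (A : TileSet R k) (A' : TileSet R k') →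
     SameOrbitTypes A A' →
       SameOrbitCount (GridRel4 R A n m) (GridRel4 R A' n m)
     × SameOrbitCount (CylRel R A n m) (CylRel R A' n m)
     × SameOrbitCount (TorusRel4 R A n m) (TorusRel4 R A' n m))
    ×
    ((n : ℕ) .{{_ : NonZero n}} →
     (R : Subgroup) →
     {k k' : ℕ} (A : TileSet R k) (A' : TileSet R k') →
     SameOrbitTypes A A' →
       SameOrbitCount (GridRel8 R A n) (GridRel8 R A' n)
     × SameOrbitCount (TorusRel8 R A n) (TorusRel8 R A' n))
mainTheorem1 =
    (λ { (suc n) (suc m) R _ A A' same →
           sameOrbitCount (grid4 R (suc n) (suc m)) A A' same
         , sameOrbitCount (cylinder R n (suc m)) A A' same
         , sameOrbitCount (torus4 R n m) A A' same })
  , (λ { (suc n) R A A' same →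
           sameOrbitCount (grid8 R (suc n)) A A' same
         , sameOrbitCount (torus8 R n) A A' same })
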